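{- Let $g \geq 5$ and $z \geq 1$ be integers. If $g$ is even and $z \leq g/2$, then $f(2,z,g) \leq g^2 - g$. If $g$ is odd and $z \leq (g+1)/2$, then $f(2,z,g) \leq g^2 - 1$.
   Context: A mixed graph $G$ is a finite graph having both undirected edges (called edges) and directed edges (called arcs). The degree of a vertex is the number of edges incident with it; its out-degree is the number of arcs directed from it. A cycle in a mixed graph is a sequence of vertices $v_0, v_1, \dots, v_k$ with $v_0 = v_k$ such that each consecutive pair $v_i, v_{i+1}$ is joined either by an edge or by an arc directed from $v_i$ to $v_{i+1}$, and no edge or arc is used more than once; its length is $k$. The girth is the length of a shortest cycle. An $(r,z,g)$-graph is a mixed graph in which every vertex has degree $r$ and out-degree $z$, and which has girth $g$. $f(r,z,g)$ denotes the minimum order of an $(r,z,g)$-graph. -}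

module Defs where

open import Data.Nat using (ℕ; zero; suc; _+_; _≤_; _<_)
open import Data.Fin using (Fin; zero; suc; inject₁; fromℕ)
open import Data.Bool using (Bool; true; false)
open import Data.Product using (Σ; _×_; _,_)
open import Data.Sum using (_⊎_)
open import Relation.Nullary using (¬_)
open import Relation.Binary.PropositionalEquality using (_≡_; _≢_)

-- A (simple, loopless) mixed graph on the vertex set Fin n.
-- edge u v = true : an undirected edge joins u and v (symmetric);
-- arc  u v = true : an arc is directed from u to v.
record MixedGraph (n : ℕ) : Set where
  field
    edge        : Fin n → Fin n → Bool
    arc         : Fin n → Fin n → Bool
    edge-sym    : ∀ u v → edge u v ≡ edge v u
    edge-irrefl : ∀ u → edge u u ≡ false
    arc-irrefl  : ∀ u → arc u u ≡ false

open MixedGraph public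

countTrue : ∀ {n} → (Fin n → Bool) → ℕ
countTrue {zero}  p = 0
countTrue {suc n} p with p zero
... | true  = suc (countTrue (λ x → p (suc x)))
... | false = countTrue (λ x → p (suc x))

degree : ∀ {n} → MixedGraph n → Fin n → ℕ
degree G u = countTrue (edge G u)

outDegree : ∀ {n} → MixedGraph n → Fin n → ℕ
outDegree G u = countTrue (arc G u)

-- A cycle of length k: vertices v 0, …, v k with v 0 = v k; step i
-- (from v i to v (i+1)) uses an edge (tag true) or an arc (tag false);
-- no edge or arc is used twice.
record Cycle {n : ℕ} (G : MixedGraph n) (k : ℕ) : Set where
  field
    vert    : Fin (suc k) → Fin n
    tag     : Fin k → Bool
    closed  : vert zero ≡ vert (fromℕ k)
    nonTriv : 1 ≤ k
    stepOK  : ∀ i → (tag i ≡ true  × edge G (vert (inject₁ i)) (vert (suc i)) ≡ true)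
                  ⊎ (tag i ≡ false × arc  G (vert (inject₁ i)) (vert (suc i)) ≡ true)
    distinct : ∀ i j → i ≢ j →
      ¬ ( (tag i ≡ true × tag j ≡ true ×
            ((vert (inject₁ i) ≡ vert (inject₁ j) × vert (suc i) ≡ vert (suc j))
             ⊎ (vert (inject₁ i) ≡ vert (suc j) × vert (suc i) ≡ vert (inject₁ j))))
        ⊎ (tag i ≡ false × tag j ≡ false ×
            vert (inject₁ i) ≡ vert (inject₁ j) × vert (suc i) ≡ vert (suc j)) )

HasGirth : ∀ {n} → MixedGraph n → ℕ → Set
HasGirth G g = Cycle G g × (∀ k → k < g → ¬ Cycle G k)

IsRZGGraph : ∀ {n} → MixedGraph n → ℕ → ℕ → ℕ → Set
IsRZGGraph G r z g =
  (∀ u → degree G u ≡ r) × (∀ u → outDegree G u ≡ z) × HasGirth G g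

-- f(r,z,g) ≤ N : some (r,z,g)-graph has order at most N
-- (equivalent to the minimum order being ≤ N)
fBoundedBy : ℕ → ℕ → ℕ → ℕ → Set
fBoundedBy r z g N = Σ ℕ λ n → n ≤ N × Σ (MixedGraph n) λ G → IsRZGGraph G r z g

{-# OPTIONS --safe #-}
-- Take m = g − 1 layers, each an undirected cycle of even length L = 2h > m (L = g for even g,
-- L = g + 1 for odd g), and from every vertex draw z arcs to the positions of its own parity among
-- the first 2z positions of the next layer, switching the parity when passing from the last layer
-- back to the first.  The potential  layer + m · (position mod 2)  taken mod 2m then grows by m
-- along every edge, in either direction, and by 1 along every arc.  So a cycle with A arcs and
-- E edges has 2m ∣ A + E m, which for A + E ≤ m forces A = 0; but an arc-free cycle stays in one
-- layer and, never reusing an edge, winds around it, so its length is a multiple of L > m.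
-- Position 0 of every layer followed by position 1 of the first layer closes a cycle of length g,
-- and the graph has m L vertices.
module Submission where

open import Defs
open import Data.Bool using (Bool; true; false; not; _∨_; if_then_else_)
open import Data.Bool.Properties using (∨-comm; ∨-zeroʳ; not-injective)
open import Data.Empty using (⊥; ⊥-elim)
open import Data.Fin using (Fin; zero; suc; toℕ; fromℕ<; inject₁; fromℕ)
open import Data.Fin.Properties using (toℕ-injective; toℕ-fromℕ<; toℕ-inject₁; toℕ-fromℕ; toℕ<n)
open import Data.Nat
open import Data.Nat.DivMod
open import Data.Nat.Divisibility
  using (_∣_; divides; ∣⇒≤; >⇒∤; ∣m+n∣m⇒∣n; n∣m*n; ∣m∣n⇒∣m+n; ∣-trans; ∣-refl)
open import Data.Nat.GeneralisedArithmetic using (fold; iterate; iterate-is-fold)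
open import Data.Nat.Properties
open import Algebra.Properties.CommutativeSemigroup +-commutativeSemigroup using (x∙yz≈y∙xz)
open import Data.Parity.Base as ℙ using (Parity; 0ℙ; 1ℙ; _⁻¹)
open import Data.Parity.Properties using (suc-homo-⁻¹; +-homo-+; p+p≡0ℙ; ⁻¹-selfInverse)
open import Data.Product using (Σ; _×_; _,_)
open import Data.Sum using (_⊎_; inj₁; inj₂)
open import Function using (_∘_; const)
open import Function.Bundles using (_⇔_; mk⇔)
open import Function.Definitions using (Injective)
open import Relation.Binary.PropositionalEquality
open import Relation.Nullary using (¬_; Dec; yes; no; does)
open import Relation.Nullary.Decidable using (dec-false; dec-true; does-⇔)

does⇒ : ∀ {p} {P : Set p} (P? : Dec P) → does P? ≡ true → P
does⇒ (yes p) _ = p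

∨≡true⇒ : ∀ a b → a ∨ b ≡ true → a ≡ true ⊎ b ≡ true
∨≡true⇒ true  _ _   = inj₁ refl
∨≡true⇒ false _ b≡t = inj₂ b≡t

does≡false⇒¬ : ∀ {p} {P : Set p} (P? : Dec P) → does P? ≡ false → ¬ P
does≡false⇒¬ (no ¬p) _ = ¬p

count : (ℕ → Bool) → ℕ → ℕ
count P zero    = 0
count P (suc n) = (if P 0 then 1 else 0) + count (P ∘ suc) n

∑ : (ℕ → ℕ) → ℕ → ℕ
∑ f zero    = 0
∑ f (suc n) = f 0 + ∑ (f ∘ suc) n

countTrue≡count : ∀ n (P : ℕ → Bool) → countTrue {n} (P ∘ toℕ) ≡ count P n
countTrue≡count zero    P = refl
countTrue≡count (suc n) P with P 0
... | true  = cong suc (countTrue≡count n (P ∘ suc))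
... | false = countTrue≡count n (P ∘ suc)

count-cong : ∀ n {P Q} → (∀ x → x < n → P x ≡ Q x) → count P n ≡ count Q n
count-cong zero    P≗Q = refl
count-cong (suc n) P≗Q =
  cong₂ _+_ (cong (λ b → if b then 1 else 0) (P≗Q 0 z<s))
            (count-cong n (λ x x<n → P≗Q (suc x) (s<s x<n)))

count-∨ : ∀ n P Q → (∀ x → x < n → P x ≡ true → Q x ≡ true → ⊥) →
  count (λ x → P x ∨ Q x) n ≡ count P n + count Q n
count-∨ zero    P Q disjoint = refl
count-∨ (suc n) P Q disjoint with P 0 in P0 | Q 0 in Q0
  | count-∨ n (P ∘ suc) (Q ∘ suc) (λ x x<n → disjoint (suc x) (s<s x<n))
... | true  | true  | _  = ⊥-elim (disjoint 0 z<s P0 Q0)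
... | true  | false | ih = cong suc ih
... | false | true  | ih = trans (cong suc ih) (sym (+-suc _ _))
... | false | false | ih = ih

count-const-false : ∀ n → count (const false) n ≡ 0
count-const-false zero    = refl
count-const-false (suc n) = count-const-false n

count-≟ : ∀ n {a} → a < n → count (λ x → does (x ≟ a)) n ≡ 1
count-≟ (suc n) {zero}  _       = cong suc (count-const-false n)
count-≟ (suc n) {suc a} (s<s a<n) = count-≟ n {a} a<n

count+count-not : ∀ n P → count P n + count (not ∘ P) n ≡ n
count+count-not zero    P = refl
count+count-not (suc n) P with P 0
... | true  = cong suc (count+count-not n (P ∘ suc))
... | false = trans (+-suc _ _) (cong suc (count+count-not n (P ∘ suc)))

count≡0⇒false : ∀ n P → count P n ≡ 0 → ∀ x → x < n → P x ≡ false
count≡0⇒false (suc n) P none x x<n with P 0 in P0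
count≡0⇒false (suc n) P none zero    _         | false = P0
count≡0⇒false (suc n) P none (suc x) (s<s x<n) | false = count≡0⇒false n (P ∘ suc) none x x<n

∑-if : ∀ k P m → ∑ (λ j → if P j then m else 1) k ≡ count (not ∘ P) k + count P k * m
∑-if zero    P m = refl
∑-if (suc k) P m with P 0
... | true  = trans (cong (m +_) (∑-if k (P ∘ suc) m)) (x∙yz≈y∙xz m (count (not ∘ P ∘ suc) k) _)
... | false = cong suc (∑-if k (P ∘ suc) m)

module _ {N : ℕ} .{{_ : NonZero N}} where

  [m%n+o]%n≡[m+o]%n : ∀ a b → (a % N + b) % N ≡ (a + b) % N
  [m%n+o]%n≡[m+o]%n a b = begin
    (a % N + b) % N         ≡⟨ %-distribˡ-+ (a % N) b N ⟩
    (a % N % N + b % N) % N ≡⟨ cong (λ u → (u + b % N) % N) (m%n%n≡m%n a N) ⟩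
    (a % N + b % N) % N     ≡⟨ %-distribˡ-+ a b N ⟨
    (a + b) % N             ∎
    where open ≡-Reasoning

  [m+n]%o≡m⇒o∣n : ∀ {a b} → a < N → (a + b) % N ≡ a → N ∣ b
  [m+n]%o≡m⇒o∣n {a} {b} a<N a+b≡a = divides ((a + b) / N) (+-cancelˡ-≡ a b _ (begin
    a + b                   ≡⟨ m≡m%n+[m/n]*n (a + b) N ⟩
    (a + b) % N + (a + b) / N * N ≡⟨ cong (_+ (a + b) / N * N) a+b≡a ⟩
    a + (a + b) / N * N     ∎))
    where open ≡-Reasoning

  [m+n*o]%o≡m : ∀ {a} b → a < N → (a + b * N) % N ≡ a
  [m+n*o]%o≡m {a} b a<N = trans ([m+kn]%n≡m%n a b N) (m<n⇒m%n≡m a<N)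

  [m+n*o]/o≡n : ∀ {a} b → a < N → (a + b * N) / N ≡ b
  [m+n*o]/o≡n {a} b a<N = begin
    (a + b * N) / N   ≡⟨ +-distrib-/ a (b * N) (subst (_< N) (sym a%N+bN%N≡a) a<N) ⟩
    a / N + b * N / N ≡⟨ cong₂ _+_ (m<n⇒m/n≡0 a<N) (m*n/n≡m b N) ⟩
    b                 ∎
    where
    open ≡-Reasoning
    a%N+bN%N≡a : a % N + b * N % N ≡ a
    a%N+bN%N≡a = trans (cong₂ _+_ (m<n⇒m%n≡m a<N) (m*n%n≡0 b N)) (+-identityʳ a)

  %-accumulate : ∀ (f w : ℕ → ℕ) K → f 0 < N → (∀ j → j < K → f (suc j) ≡ (f j + w j) % N) →
    f K ≡ (f 0 + ∑ w K) % N
  %-accumulate f w zero    f0<N _    = sym (trans (cong (_% N) (+-identityʳ _)) (m<n⇒m%n≡m f0<N))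
  %-accumulate f w (suc K) f0<N step = begin
    f (suc K)                             ≡⟨ %-accumulate (f ∘ suc) (w ∘ suc) K f1<N (λ j → step (suc j) ∘ s<s) ⟩
    (f 1 + ∑ (w ∘ suc) K) % N             ≡⟨ cong (λ u → (u + ∑ (w ∘ suc) K) % N) (step 0 z<s) ⟩
    ((f 0 + w 0) % N + ∑ (w ∘ suc) K) % N ≡⟨ [m%n+o]%n≡[m+o]%n (f 0 + w 0) _ ⟩
    (f 0 + w 0 + ∑ (w ∘ suc) K) % N       ≡⟨ cong (_% N) (+-assoc (f 0) (w 0) _) ⟩
    (f 0 + ∑ w (suc K)) % N               ∎
    where
    open ≡-Reasoning
    f1<N : f 1 < N
    f1<N = subst (_< N) (sym (step 0 z<s)) (m%n<n _ N)

m+m∣a+e*m⇒a≡0 : ∀ a e m → 0 < a + e → a + e ≤ m → (m + m) ∣ a + e * m → a ≡ 0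
m+m∣a+e*m⇒a≡0 zero    e       m _   _     _   = refl
m+m∣a+e*m⇒a≡0 (suc a) zero    m _   a+e≤m 2m∣a = ⊥-elim (n≮n m (begin-strict
  m         <⟨ m<m+n m (<-≤-trans z<s a+e≤m) ⟩
  m + m     ≤⟨ ∣⇒≤ 2m∣a ⟩
  suc a + 0 ≤⟨ a+e≤m ⟩
  m         ∎))
  where open ≤-Reasoning
m+m∣a+e*m⇒a≡0 (suc a) (suc e) m _   a+e≤m 2m∣a+em = ⊥-elim (n≮n m (begin-strict
  m             ≤⟨ ∣⇒≤ m∣a ⟩
  suc a         <⟨ m<m+n (suc a) z<s ⟩
  suc a + suc e ≤⟨ a+e≤m ⟩
  m             ∎))
  where
  open ≤-Reasoning
  m∣a+em : m ∣ suc e * m + suc a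
  m∣a+em = subst (m ∣_) (+-comm (suc a) (suc e * m)) (∣-trans (∣m∣n⇒∣m+n ∣-refl ∣-refl) 2m∣a+em)
  m∣a : m ∣ suc a
  m∣a = ∣m+n∣m⇒∣n m∣a+em (n∣m*n (suc e))

record NonBacktrackingWalk {a} {A : Set a} (s : A → A) (V : ℕ → A) (K : ℕ) : Set a where
  field
    along     : ∀ j → j < K → V (suc j) ≡ s (V j) ⊎ V j ≡ s (V (suc j))
    no-return : ∀ j → suc (suc j) ≤ K → V (suc (suc j)) ≢ V j

open NonBacktrackingWalk

module _ {a} {A : Set a} {s : A → A} (s-injective : Injective _≡_ _≡_ s) {V : ℕ → A} where

  walk-oriented : ∀ {K} → NonBacktrackingWalk s V K →
    (∀ j → j < K → V (suc j) ≡ s (V j)) ⊎ (∀ j → j < K → V j ≡ s (V (suc j)))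
  walk-oriented {zero}  _ = inj₁ (λ _ ())
  walk-oriented {suc K} W with along W 0 z<s
  ... | inj₁ forward₀  = inj₁ forward
    where
    forward : ∀ j → j < suc K → V (suc j) ≡ s (V j)
    forward zero    _   = forward₀
    forward (suc j) j<K with along W (suc j) j<K
    ... | inj₁ fwd = fwd
    ... | inj₂ bwd =
      ⊥-elim (no-return W j j<K (sym (s-injective (trans (sym (forward j (<-trans (n<1+n j) j<K))) bwd))))
  ... | inj₂ backward₀ = inj₂ backward
    where
    backward : ∀ j → j < suc K → V j ≡ s (V (suc j))
    backward zero    _   = backward₀
    backward (suc j) j<K with along W (suc j) j<K
    ... | inj₂ bwd = bwd
    ... | inj₁ fwd = ⊥-elim (no-return W j j<K (trans fwd (sym (backward j (<-trans (n<1+n j) j<K)))))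

  closedWalk⇒periodic : ∀ {K} → NonBacktrackingWalk s V K → V K ≡ V 0 → fold (V 0) s K ≡ V 0
  closedWalk⇒periodic {K} W closed with walk-oriented W
  ... | inj₁ forward  = trans (sym (orbit K ≤-refl)) closed
    where
    orbit : ∀ j → j ≤ K → V j ≡ fold (V 0) s j
    orbit zero    _   = refl
    orbit (suc j) j<K = trans (forward j j<K) (cong s (orbit j (<⇒≤ j<K)))
  ... | inj₂ backward = begin
    fold (V 0) s K    ≡⟨ iterate-is-fold (V 0) s K ⟩
    iterate s (V 0) K ≡⟨ cong (λ x → iterate s x K) closed ⟨
    iterate s (V K) K ≡⟨ orbit K ≤-refl ⟨
    V 0               ∎
    where
    open ≡-Reasoning
    orbit : ∀ j → j ≤ K → V 0 ≡ iterate s (V j) j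
    orbit zero    _   = refl
    orbit (suc j) j<K = trans (orbit j (<⇒≤ j<K)) (cong (λ x → iterate s x j) (backward j j<K))

module CycleSequence {n k} {G : MixedGraph n} (C : Cycle G k) where
  open Cycle C

  vertexAt : ℕ → Fin n
  vertexAt j with j <? suc k
  ... | yes j≤k = vert (fromℕ< j≤k)
  ... | no  _   = vert zero

  tagAt : ℕ → Bool
  tagAt j with j <? k
  ... | yes j<k = tag (fromℕ< j<k)
  ... | no  _   = false

  vertexAt-fromℕ< : ∀ {j} (j≤k : j < suc k) → vertexAt j ≡ vert (fromℕ< j≤k)
  vertexAt-fromℕ< {j} j≤k with j <? suc k
  ... | yes _   = refl
  ... | no  j≰k = ⊥-elim (j≰k j≤k)

  tagAt-fromℕ< : ∀ {j} (j<k : j < k) → tagAt j ≡ tag (fromℕ< j<k)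
  tagAt-fromℕ< {j} j<k with j <? k
  ... | yes _   = refl
  ... | no  j≮k = ⊥-elim (j≮k j<k)

  vertexAt-source : ∀ {j} (j<k : j < k) → vert (inject₁ (fromℕ< j<k)) ≡ vertexAt j
  vertexAt-source {j} j<k = trans (cong vert (toℕ-injective (begin
    toℕ (inject₁ (fromℕ< j<k))         ≡⟨ toℕ-inject₁ _ ⟩
    toℕ (fromℕ< j<k)                   ≡⟨ toℕ-fromℕ< j<k ⟩
    j                                  ≡⟨ toℕ-fromℕ< (<-trans j<k (n<1+n k)) ⟨
    toℕ (fromℕ< (<-trans j<k (n<1+n k))) ∎)))
    (sym (vertexAt-fromℕ< (<-trans j<k (n<1+n k))))
    where open ≡-Reasoning

  vertexAt-target : ∀ {j} (j<k : j < k) → vert (suc (fromℕ< j<k)) ≡ vertexAt (suc j)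
  vertexAt-target {j} j<k = trans (cong vert (toℕ-injective (trans (cong suc (toℕ-fromℕ< j<k))
    (sym (toℕ-fromℕ< (s<s j<k)))))) (sym (vertexAt-fromℕ< (s<s j<k)))

  vertexAt-closed : vertexAt k ≡ vertexAt 0
  vertexAt-closed = begin
    vertexAt k                 ≡⟨ vertexAt-fromℕ< (n<1+n k) ⟩
    vert (fromℕ< (n<1+n k))    ≡⟨ cong vert (toℕ-injective (trans (toℕ-fromℕ< _) (sym (toℕ-fromℕ k)))) ⟩
    vert (fromℕ k)             ≡⟨ closed ⟨
    vert zero                  ≡⟨ vertexAt-fromℕ< z<s ⟨
    vertexAt 0                 ∎
    where open ≡-Reasoning

  stepAt : ∀ j → j < k →
      (tagAt j ≡ true  × edge G (vertexAt j) (vertexAt (suc j)) ≡ true)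
    ⊎ (tagAt j ≡ false × arc  G (vertexAt j) (vertexAt (suc j)) ≡ true)
  stepAt j j<k with stepOK (fromℕ< j<k)
  ... | inj₁ (t , e) = inj₁ (trans (tagAt-fromℕ< j<k) t ,
    subst₂ (λ u v → edge G u v ≡ true) (vertexAt-source j<k) (vertexAt-target j<k) e)
  ... | inj₂ (t , a) = inj₂ (trans (tagAt-fromℕ< j<k) t ,
    subst₂ (λ u v → arc G u v ≡ true) (vertexAt-source j<k) (vertexAt-target j<k) a)

  edge-not-retraced : ∀ j → suc (suc j) ≤ k → tagAt j ≡ true → tagAt (suc j) ≡ true →
    vertexAt (suc (suc j)) ≢ vertexAt j
  edge-not-retraced j j+1<k t₀ t₁ retraced =
    distinct i i′ i≢i′ (inj₁ (trans (sym (tagAt-fromℕ< j<k)) t₀ , trans (sym (tagAt-fromℕ< j+1<k)) t₁ ,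
      inj₂ (trans (vertexAt-source j<k) (trans (sym retraced) (sym (vertexAt-target j+1<k))) ,
            trans (vertexAt-target j<k) (sym (vertexAt-source j+1<k)))))
    where
    j<k : j < k
    j<k = <-trans (n<1+n j) j+1<k
    i i′ : Fin k
    i  = fromℕ< j<k
    i′ = fromℕ< j+1<k
    i≢i′ : i ≢ i′
    i≢i′ i≡i′ = <⇒≢ (n<1+n j) (trans (sym (toℕ-fromℕ< j<k)) (trans (cong toℕ i≡i′) (toℕ-fromℕ< j+1<k)))

parity-suc : ∀ n → parity (suc n) ≡ parity n ⁻¹
parity-suc n = sym (⁻¹-selfInverse (suc-homo-⁻¹ n))

parity-double+ : ∀ c r → parity (c + c + r) ≡ parity r
parity-double+ c r = begin
  parity (c + c + r)                    ≡⟨ +-homo-+ (c + c) r ⟩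
  parity (c + c) ℙ.+ parity r           ≡⟨ cong (ℙ._+ parity r) (trans (+-homo-+ c c) (p+p≡0ℙ (parity c))) ⟩
  parity r                              ∎
  where open ≡-Reasoning

bit : Parity → ℕ
bit 0ℙ = 0
bit 1ℙ = 1

parity-bit : ∀ p → parity (bit p) ≡ p
parity-bit 0ℙ = refl
parity-bit 1ℙ = refl

bit≤1 : ∀ p → bit p ≤ 1
bit≤1 0ℙ = z≤n
bit≤1 1ℙ = s≤s z≤n

module LayeredCycles (m h z : ℕ) (2≤m : 2 ≤ m) (m<L : m < h + h) (1≤z : 1 ≤ z) (z≤h : z ≤ h) where

  L n M : ℕ
  L = h + h
  n = m * L
  M = m + m

  0<m : 0 < m
  0<m = <-≤-trans z<s 2≤m

  2<L : 2 < L
  2<L = ≤-<-trans 2≤m m<L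

  1<L : 1 < L
  1<L = <-trans (n<1+n 1) 2<L

  0<L : 0 < L
  0<L = <-trans z<s 1<L

  instance
    L-nonZero : NonZero L
    L-nonZero = >-nonZero 0<L
    M-nonZero : NonZero M
    M-nonZero = >-nonZero (<-≤-trans 0<m (m≤m+n m m))

  layer pos : ℕ → ℕ
  layer x = x / L
  pos   x = x % L

  vertex : ℕ → ℕ → ℕ
  vertex t a = t + a * L

  vertex-pos-layer : ∀ x → vertex (pos x) (layer x) ≡ x
  vertex-pos-layer x = sym (m≡m%n+[m/n]*n x L)

  pos<L : ∀ x → pos x < L
  pos<L x = m%n<n x L

  layer<m : ∀ {x} → x < n → layer x < m
  layer<m x<n = m<n*o⇒m/o<n x<n

  pos-vertex : ∀ {t} a → t < L → pos (vertex t a) ≡ t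
  pos-vertex a t<L = [m+n*o]%o≡m a t<L

  layer-vertex : ∀ {t} a → t < L → layer (vertex t a) ≡ a
  layer-vertex a t<L = [m+n*o]/o≡n a t<L

  vertex<n : ∀ {t a} → t < L → a < m → vertex t a < n
  vertex<n {t} {a} t<L a<m = begin-strict
    t + a * L <⟨ +-monoˡ-< (a * L) t<L ⟩
    suc a * L ≤⟨ *-monoˡ-≤ L a<m ⟩
    m * L     ∎
    where open ≤-Reasoning

  next prev : ℕ → ℕ
  next t = (t + 1) % L
  prev zero    = pred L
  prev (suc t) = t

  next-cases : ∀ {t} → t < L → (suc t < L × next t ≡ suc t) ⊎ (suc t ≡ L × next t ≡ 0)
  next-cases {t} t<L with m≤n⇒m<n∨m≡n t<L
  ... | inj₁ t+1<L = inj₁ (t+1<L , trans (cong (_% L) (+-comm t 1)) (m<n⇒m%n≡m t+1<L))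
  ... | inj₂ t+1≡L = inj₂ (t+1≡L , trans (cong (_% L) (trans (+-comm t 1) t+1≡L)) (n%n≡0 L))

  prev<L : ∀ {t} → t < L → prev t < L
  prev<L {zero}  _   = ≤-reflexive (suc-pred L)
  prev<L {suc t} t<L = <-trans (n<1+n t) t<L

  next-prev : ∀ {t} → t < L → next (prev t) ≡ t
  next-prev {zero}  _   = trans (cong (_% L) (trans (+-comm (pred L) 1) (suc-pred L))) (n%n≡0 L)
  next-prev {suc t} t<L = trans (cong (_% L) (+-comm t 1)) (m<n⇒m%n≡m t<L)

  prev-next : ∀ {t} → t < L → prev (next t) ≡ t
  prev-next t<L with next-cases t<L
  ... | inj₁ (_ , next≡) rewrite next≡ = refl
  ... | inj₂ (t+1≡L , next≡) rewrite next≡ = sym (cong pred t+1≡L)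

  parity-next : ∀ {t} → t < L → parity (next t) ≡ parity t ⁻¹
  parity-next {t} t<L with next-cases t<L
  ... | inj₁ (_ , next≡) rewrite next≡ = parity-suc t
  ... | inj₂ (t+1≡L , next≡) rewrite next≡ = sym (begin
    parity t ⁻¹     ≡⟨ parity-suc t ⟨
    parity (suc t)  ≡⟨ cong parity (trans t+1≡L (sym (+-identityʳ L))) ⟩
    parity (h + h + 0) ≡⟨ parity-double+ h 0 ⟩
    0ℙ              ∎)
    where open ≡-Reasoning

  rotate rotate⁻¹ : ℕ → ℕ
  rotate   x = vertex (next (pos x)) (layer x)
  rotate⁻¹ x = vertex (prev (pos x)) (layer x)

  pos-rotate : ∀ x → pos (rotate x) ≡ next (pos x)
  pos-rotate x = pos-vertex (layer x) (m%n<n _ L)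

  layer-rotate : ∀ x → layer (rotate x) ≡ layer x
  layer-rotate x = layer-vertex (layer x) (m%n<n _ L)

  rotate<n : ∀ {x} → x < n → rotate x < n
  rotate<n x<n = vertex<n (m%n<n _ L) (layer<m x<n)

  rotate⁻¹<n : ∀ {x} → x < n → rotate⁻¹ x < n
  rotate⁻¹<n {x} x<n = vertex<n (prev<L (pos<L x)) (layer<m x<n)

  rotate-rotate⁻¹ : ∀ x → rotate (rotate⁻¹ x) ≡ x
  rotate-rotate⁻¹ x = begin
    vertex (next (pos (rotate⁻¹ x))) (layer (rotate⁻¹ x))
      ≡⟨ cong₂ (λ t a → vertex (next t) a) (pos-vertex (layer x) prev<) (layer-vertex (layer x) prev<) ⟩
    vertex (next (prev (pos x))) (layer x) ≡⟨ cong (λ t → vertex t (layer x)) (next-prev (pos<L x)) ⟩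
    vertex (pos x) (layer x)               ≡⟨ vertex-pos-layer x ⟩
    x                                      ∎
    where
    open ≡-Reasoning
    prev< = prev<L (pos<L x)

  rotate⁻¹-rotate : ∀ x → rotate⁻¹ (rotate x) ≡ x
  rotate⁻¹-rotate x = begin
    vertex (prev (pos (rotate x))) (layer (rotate x))
      ≡⟨ cong₂ (λ t a → vertex (prev t) a) (pos-rotate x) (layer-rotate x) ⟩
    vertex (prev (next (pos x))) (layer x) ≡⟨ cong (λ t → vertex t (layer x)) (prev-next (pos<L x)) ⟩
    vertex (pos x) (layer x)               ≡⟨ vertex-pos-layer x ⟩
    x                                      ∎
    where open ≡-Reasoning

  rotate-injective : ∀ {x y} → rotate x ≡ rotate y → x ≡ y
  rotate-injective {x} {y} eq = trans (sym (rotate⁻¹-rotate x)) (trans (cong rotate⁻¹ eq) (rotate⁻¹-rotate y))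

  pos-fold-rotate : ∀ x j → pos (fold x rotate j) ≡ (pos x + j) % L
  pos-fold-rotate x zero    = sym (trans (cong (_% L) (+-identityʳ (pos x))) (m%n%n≡m%n x L))
  pos-fold-rotate x (suc j) = begin
    pos (rotate (fold x rotate j))   ≡⟨ pos-rotate _ ⟩
    (pos (fold x rotate j) + 1) % L  ≡⟨ cong (λ t → (t + 1) % L) (pos-fold-rotate x j) ⟩
    ((pos x + j) % L + 1) % L        ≡⟨ [m%n+o]%n≡[m+o]%n (pos x + j) 1 ⟩
    (pos x + j + 1) % L              ≡⟨ cong (_% L) (trans (+-assoc (pos x) j 1) (cong (pos x +_) (+-comm j 1))) ⟩
    (pos x + suc j) % L              ∎
    where open ≡-Reasoning

  rotate-period : ∀ {x j} → fold x rotate j ≡ x → L ∣ j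
  rotate-period {x} {j} periodic =
    [m+n]%o≡m⇒o∣n (pos<L x) (trans (sym (pos-fold-rotate x j)) (cong pos periodic))

  rotate≢id : ∀ x → rotate x ≢ x
  rotate≢id x fixed = >⇒∤ 1<L (rotate-period {j = 1} fixed)

  rotate²≢id : ∀ x → rotate (rotate x) ≢ x
  rotate²≢id x fixed = >⇒∤ 2<L (rotate-period {j = 2} fixed)

  rotate≢rotate⁻¹ : ∀ x → rotate x ≢ rotate⁻¹ x
  rotate≢rotate⁻¹ x eq = rotate²≢id x (trans (cong rotate eq) (rotate-rotate⁻¹ x))

  isEdge : ℕ → ℕ → Bool
  isEdge x y = does (y ≟ rotate x) ∨ does (x ≟ rotate y)

  isEdge-sym : ∀ x y → isEdge x y ≡ isEdge y x
  isEdge-sym x y = ∨-comm (does (y ≟ rotate x)) (does (x ≟ rotate y))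

  isEdge-irrefl : ∀ x → isEdge x x ≡ false
  isEdge-irrefl x = cong₂ _∨_ x≢rx x≢rx
    where x≢rx = dec-false (x ≟ rotate x) (rotate≢id x ∘ sym)

  isEdge⇒rotate : ∀ x y → isEdge x y ≡ true → y ≡ rotate x ⊎ x ≡ rotate y
  isEdge⇒rotate x y e with ∨≡true⇒ (does (y ≟ rotate x)) _ e
  ... | inj₁ y≡rx = inj₁ (does⇒ (y ≟ rotate x) y≡rx)
  ... | inj₂ x≡ry = inj₂ (does⇒ (x ≟ rotate y) x≡ry)

  ≡rotate⇔rotate⁻¹≡ : ∀ {x y} → x ≡ rotate y ⇔ y ≡ rotate⁻¹ x
  ≡rotate⇔rotate⁻¹≡ {x} {y} = mk⇔
    (λ x≡ry → trans (sym (rotate⁻¹-rotate y)) (cong rotate⁻¹ (sym x≡ry)))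
    (λ y≡r⁻¹x → trans (sym (rotate-rotate⁻¹ x)) (cong rotate (sym y≡r⁻¹x)))

  edgeDegree : ∀ {x} → x < n → count (isEdge x) n ≡ 2
  edgeDegree {x} x<n = begin
    count (isEdge x) n
      ≡⟨ count-cong n (λ y _ → cong (does (y ≟ rotate x) ∨_)
                                    (does-⇔ ≡rotate⇔rotate⁻¹≡ (x ≟ rotate y) (y ≟ rotate⁻¹ x))) ⟩
    count (λ y → does (y ≟ rotate x) ∨ does (y ≟ rotate⁻¹ x)) n
      ≡⟨ count-∨ n _ _ (λ y _ y≡rx y≡r⁻¹x →
           rotate≢rotate⁻¹ x (trans (sym (does⇒ (y ≟ _) y≡rx)) (does⇒ (y ≟ _) y≡r⁻¹x))) ⟩
    count (λ y → does (y ≟ rotate x)) n + count (λ y → does (y ≟ rotate⁻¹ x)) n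
      ≡⟨ cong₂ _+_ (count-≟ n (rotate<n x<n)) (count-≟ n (rotate⁻¹<n x<n)) ⟩
    2 ∎
    where open ≡-Reasoning

  headLayer : ℕ → ℕ
  headLayer a with suc a ≟ m
  ... | yes _ = 0
  ... | no  _ = suc a

  headParity : ℕ → Parity → Parity
  headParity a p with suc a ≟ m
  ... | yes _ = p ⁻¹
  ... | no  _ = p

  targets : ℕ → ℕ → ℕ → ℕ → Bool
  targets zero    r a y = false
  targets (suc c) r a y = targets c r a y ∨ does (y ≟ vertex (c + c + r) a)

  isArc : ℕ → ℕ → Bool
  isArc x y = targets z (bit (headParity (layer x) (parity (pos x)))) (headLayer (layer x)) y

  headLayer<m : ∀ {a} → a < m → headLayer a < m
  headLayer<m {a} a<m with suc a ≟ m
  ... | yes _      = 0<m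
  ... | no  a+1≢m = ≤∧≢⇒< a<m a+1≢m

  headLayer≢ : ∀ a → headLayer a ≢ a
  headLayer≢ a with suc a ≟ m
  ... | yes a+1≡m = λ 0≡a → <⇒≢ 2≤m (trans (cong suc 0≡a) a+1≡m)
  ... | no  _     = λ a+1≡a → <⇒≢ (n<1+n a) (sym a+1≡a)

  double+bit<L : ∀ {c r} → c < h → r ≤ 1 → c + c + r < L
  double+bit<L {c} {r} c<h r≤1 = begin-strict
    c + c + r   ≤⟨ +-monoʳ-≤ (c + c) r≤1 ⟩
    c + c + 1   ≡⟨ +-comm (c + c) 1 ⟩
    suc (c + c) <⟨ s≤s (+-monoʳ-< c (n<1+n c)) ⟩
    suc c + suc c ≤⟨ +-mono-≤ c<h c<h ⟩
    L           ∎
    where open ≤-Reasoning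

  targets⇒ : ∀ c r a y → targets c r a y ≡ true → Σ ℕ λ d → d < c × y ≡ vertex (d + d + r) a
  targets⇒ (suc c) r a y e with ∨≡true⇒ (targets c r a y) _ e
  ... | inj₁ earlier = let (d , d<c , y≡) = targets⇒ c r a y earlier in d , m<n⇒m<1+n d<c , y≡
  ... | inj₂ last    = c , n<1+n c , does⇒ (y ≟ _) last

  targets-∋ : ∀ {c d} r a → d < c → targets c r a (vertex (d + d + r) a) ≡ true
  targets-∋ {suc c} {d} r a d<c+1 with m≤n⇒m<n∨m≡n (s≤s⁻¹ d<c+1)
  ... | inj₁ d<c  rewrite targets-∋ r a d<c = refl
  ... | inj₂ refl = trans (cong (targets c r a y ∨_) (dec-true (y ≟ y) refl)) (∨-zeroʳ _)
    where y = vertex (c + c + r) a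

  count-targets : ∀ {c r a} → c ≤ h → r ≤ 1 → a < m → count (targets c r a) n ≡ c
  count-targets {zero}          _     _   _   = count-const-false n
  count-targets {suc c} {r} {a} c<h r≤1 a<m = begin
    count (λ y → targets c r a y ∨ does (y ≟ vertex (c + c + r) a)) n
      ≡⟨ count-∨ n (targets c r a) _ disjoint ⟩
    count (targets c r a) n + count (λ y → does (y ≟ vertex (c + c + r) a)) n
      ≡⟨ cong₂ _+_ (count-targets (<⇒≤ c<h) r≤1 a<m) (count-≟ n (vertex<n (double+bit<L c<h r≤1) a<m)) ⟩
    c + 1 ≡⟨ +-comm c 1 ⟩
    suc c ∎
    where
    open ≡-Reasoning
    disjoint : ∀ y → y < n → targets c r a y ≡ true → does (y ≟ vertex (c + c + r) a) ≡ true → ⊥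
    disjoint y _ earlier last with targets⇒ c r a y earlier
    ... | d , d<c , y≡ = <⇒≢ (+-monoˡ-< (a * L) (+-monoˡ-< r (+-mono-< d<c d<c)))
                             (trans (sym y≡) (does⇒ (y ≟ _) last))

  arcDegree : ∀ {x} → x < n → count (isArc x) n ≡ z
  arcDegree x<n = count-targets z≤h (bit≤1 _) (headLayer<m (layer<m x<n))

  isArc-irrefl : ∀ {x} → x < n → isArc x x ≡ false
  isArc-irrefl {x} x<n with isArc x x in loop
  ... | false = refl
  ... | true with targets⇒ z _ _ x loop
  ...   | d , d<z , x≡ = ⊥-elim (headLayer≢ (layer x) (sym (trans (cong layer x≡)
            (layer-vertex _ (double+bit<L (<-≤-trans d<z z≤h) (bit≤1 _))))))

  offset : Parity → ℕ
  offset 0ℙ = 0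
  offset 1ℙ = m

  offset≤m : ∀ p → offset p ≤ m
  offset≤m 0ℙ = z≤n
  offset≤m 1ℙ = ≤-refl

  potential : ℕ → ℕ
  potential x = layer x + offset (parity (pos x))

  potential<M : ∀ {x} → x < n → potential x < M
  potential<M {x} x<n = +-mono-<-≤ (layer<m x<n) (offset≤m (parity (pos x)))

  offset-flip : ∀ {a} p → a < m → a + offset (p ⁻¹) ≡ (a + offset p + m) % M
  offset-flip {a} 1ℙ a<m = sym (begin
    (a + m + m) % M ≡⟨ cong (_% M) (+-assoc a m m) ⟩
    (a + M) % M     ≡⟨ [m+n]%n≡m%n a M ⟩
    a % M           ≡⟨ m<n⇒m%n≡m (<-≤-trans a<m (m≤m+n m m)) ⟩
    a               ≡⟨ +-identityʳ a ⟨
    a + 0           ∎)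
    where open ≡-Reasoning
  offset-flip {a} 0ℙ a<m =
    sym (trans (cong (λ u → (u + m) % M) (+-identityʳ a)) (m<n⇒m%n≡m (+-monoˡ-< m a<m)))

  potential-rotate : ∀ {x} → x < n → potential (rotate x) ≡ (potential x + m) % M
  potential-rotate {x} x<n = begin
    layer (rotate x) + offset (parity (pos (rotate x)))
      ≡⟨ cong₂ (λ a p → a + offset p)
               (layer-rotate x) (trans (cong parity (pos-rotate x)) (parity-next (pos<L x))) ⟩
    layer x + offset (parity (pos x) ⁻¹)
      ≡⟨ offset-flip (parity (pos x)) (layer<m x<n) ⟩
    (potential x + m) % M ∎
    where open ≡-Reasoning

  potential-rotate-backward : ∀ {x} → x < n → potential x ≡ (potential (rotate x) + m) % M
  potential-rotate-backward {x} x<n = sym (begin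
    (potential (rotate x) + m) % M     ≡⟨ cong (λ u → (u + m) % M) (potential-rotate x<n) ⟩
    ((potential x + m) % M + m) % M    ≡⟨ [m%n+o]%n≡[m+o]%n {N = M} (potential x + m) m ⟩
    (potential x + m + m) % M          ≡⟨ cong (_% M) (+-assoc (potential x) m m) ⟩
    (potential x + M) % M              ≡⟨ [m+n]%n≡m%n (potential x) M ⟩
    potential x % M                    ≡⟨ m<n⇒m%n≡m (potential<M x<n) ⟩
    potential x                        ∎)
    where open ≡-Reasoning

  potential-edge : ∀ {x y} → x < n → y < n → isEdge x y ≡ true → potential y ≡ (potential x + m) % M
  potential-edge {x} {y} x<n y<n e with isEdge⇒rotate x y e
  ... | inj₁ refl = potential-rotate x<n
  ... | inj₂ refl = potential-rotate-backward y<n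

  offset-head : ∀ {a} p → a < m → headLayer a + offset (headParity a p) ≡ (a + offset p + 1) % M
  offset-head {a} p a<m with suc a ≟ m
  ... | no a+1≢m = sym (trans (cong (_% M) (+-comm (a + offset p) 1))
                              (m<n⇒m%n≡m (+-mono-<-≤ (≤∧≢⇒< a<m a+1≢m) (offset≤m p))))
  ... | yes a+1≡m with p
  ...   | 0ℙ = sym (trans (cong (_% M) (trans (+-comm (a + 0) 1) (cong suc (+-identityʳ a))))
                      (trans (cong (_% M) a+1≡m) (m<n⇒m%n≡m (m<m+n m 0<m))))
  ...   | 1ℙ = sym (trans (cong (_% M) (trans (+-comm (a + m) 1) (cong (_+ m) a+1≡m))) (n%n≡0 M))

  potential-arc : ∀ {x y} → x < n → isArc x y ≡ true → potential y ≡ (potential x + 1) % M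
  potential-arc {x} {y} x<n e with targets⇒ z _ _ y e
  ... | d , d<z , refl = begin
    potential (vertex t (headLayer a))
      ≡⟨ cong₂ (λ a′ t′ → a′ + offset (parity t′))
               (layer-vertex (headLayer a) t<L) (pos-vertex (headLayer a) t<L) ⟩
    headLayer a + offset (parity t)
      ≡⟨ cong (λ p → headLayer a + offset p) (trans (parity-double+ d (bit p)) (parity-bit p)) ⟩
    headLayer a + offset p
      ≡⟨ offset-head (parity (pos x)) (layer<m x<n) ⟩
    (potential x + 1) % M ∎
    where
    open ≡-Reasoning
    a = layer x
    p = headParity a (parity (pos x))
    t = d + d + bit p
    t<L : t < L
    t<L = double+bit<L (<-≤-trans d<z z≤h) (bit≤1 p)

  graph : MixedGraph n
  graph = record
    { edge        = λ u v → isEdge (toℕ u) (toℕ v)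
    ; arc         = λ u v → isArc (toℕ u) (toℕ v)
    ; edge-sym    = λ u v → isEdge-sym (toℕ u) (toℕ v)
    ; edge-irrefl = λ u → isEdge-irrefl (toℕ u)
    ; arc-irrefl  = λ u → isArc-irrefl (toℕ<n u)
    }

  graph-degree : ∀ u → degree graph u ≡ 2
  graph-degree u = trans (countTrue≡count n (isEdge (toℕ u))) (edgeDegree (toℕ<n u))

  graph-outDegree : ∀ u → outDegree graph u ≡ z
  graph-outDegree u = trans (countTrue≡count n (isArc (toℕ u))) (arcDegree (toℕ<n u))

  module ShortCycle {k} (C : Cycle graph k) where
    open CycleSequence C
    open Cycle C using (nonTriv)

    V : ℕ → ℕ
    V = toℕ ∘ vertexAt

    weight : ℕ → ℕ
    weight j = if tagAt j then m else 1

    potential-step : ∀ j → j < k → potential (V (suc j)) ≡ (potential (V j) + weight j) % M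
    potential-step j j<k with stepAt j j<k
    ... | inj₁ (t , e) rewrite t = potential-edge (toℕ<n _) (toℕ<n _) e
    ... | inj₂ (t , a) rewrite t = potential-arc (toℕ<n _) a

    arcFree : k ≤ m → ∀ j → j < k → tagAt j ≡ true
    arcFree k≤m j j<k = not-injective (count≡0⇒false k (not ∘ tagAt) noArcs j j<k)
      where
      M∣weights : M ∣ ∑ weight k
      M∣weights = [m+n]%o≡m⇒o∣n (potential<M (toℕ<n _)) (begin
        (potential (V 0) + ∑ weight k) % M
          ≡⟨ %-accumulate (potential ∘ V) weight k (potential<M (toℕ<n _)) potential-step ⟨
        potential (V k)                    ≡⟨ cong (potential ∘ toℕ) vertexAt-closed ⟩
        potential (V 0)                    ∎)
        where open ≡-Reasoning
      noArcs : count (not ∘ tagAt) k ≡ 0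
      noArcs = m+m∣a+e*m⇒a≡0 _ _ m
        (subst (0 <_) (sym k≡) nonTriv) (subst (_≤ m) (sym k≡) k≤m)
        (subst (M ∣_) (∑-if k tagAt m) M∣weights)
        where
        k≡ : count (not ∘ tagAt) k + count tagAt k ≡ k
        k≡ = trans (+-comm (count (not ∘ tagAt) k) _) (count+count-not k tagAt)

    arcFree⇒L∣length : (∀ j → j < k → tagAt j ≡ true) → L ∣ k
    arcFree⇒L∣length allEdges =
      rotate-period (closedWalk⇒periodic rotate-injective walk (cong toℕ vertexAt-closed))
      where
      edgeStep : ∀ j → j < k → isEdge (V j) (V (suc j)) ≡ true
      edgeStep j j<k with stepAt j j<k
      ... | inj₁ (_ , e) = e
      ... | inj₂ (t , _) with trans (sym (allEdges j j<k)) t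
      ...   | ()
      walk : NonBacktrackingWalk rotate V k
      walk = record
        { along     = λ j j<k → isEdge⇒rotate (V j) (V (suc j)) (edgeStep j j<k)
        ; no-return = λ j j+1<k → edge-not-retraced j j+1<k (allEdges j (<-trans (n<1+n j) j+1<k))
                                      (allEdges (suc j) j+1<k) ∘ toℕ-injective
        }

  noShortCycle : ∀ k → k < suc m → ¬ Cycle graph k
  noShortCycle k k<g C =
    >⇒∤ {{>-nonZero (Cycle.nonTriv C)}} (≤-<-trans k≤m m<L) (arcFree⇒L∣length (arcFree k≤m))
    where
    open ShortCycle C
    k≤m = s≤s⁻¹ k<g

  girthWalk : ℕ → ℕ
  girthWalk j with j <? m
  ... | yes _ = vertex 0 j
  ... | no  _ with j ≟ m
  ...   | yes _ = vertex 1 0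
  ...   | no  _ = vertex 0 0

  girthWalk-< : ∀ {j} → j < m → girthWalk j ≡ vertex 0 j
  girthWalk-< {j} j<m with j <? m
  ... | yes _   = refl
  ... | no  j≮m = ⊥-elim (j≮m j<m)

  girthWalk-m : girthWalk m ≡ vertex 1 0
  girthWalk-m with m <? m
  ... | yes m<m = ⊥-elim (n≮n m m<m)
  ... | no  _ with m ≟ m
  ...   | yes _   = refl
  ...   | no  m≢m = ⊥-elim (m≢m refl)

  girthWalk-end : girthWalk (suc m) ≡ vertex 0 0
  girthWalk-end with suc m <? m
  ... | yes m+1<m = ⊥-elim (n≮n m (<-trans (n<1+n m) m+1<m))
  ... | no  _ with suc m ≟ m
  ...   | yes m+1≡m = ⊥-elim (<⇒≢ (n<1+n m) (sym m+1≡m))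
  ...   | no  _     = refl

  girthWalk<n : ∀ j → girthWalk j < n
  girthWalk<n j with j <? m
  ... | yes j<m = vertex<n 0<L j<m
  ... | no  _ with j ≟ m
  ...   | yes _ = vertex<n 1<L 0<m
  ...   | no  _ = vertex<n 0<L 0<m

  isArc-vertex : ∀ {t a} → t < L → isArc (vertex t a) ≗ targets z (bit (headParity a (parity t))) (headLayer a)
  isArc-vertex {t} {a} t<L y =
    cong₂ (λ a′ t′ → targets z (bit (headParity a′ (parity t′))) (headLayer a′) y)
          (layer-vertex a t<L) (pos-vertex a t<L)

  girthArc : ∀ {j} → j < m → isArc (girthWalk j) (girthWalk (suc j)) ≡ true
  girthArc {j} j<m rewrite girthWalk-< j<m = trans (isArc-vertex 0<L _) arcToNextCopy
    where
    arcToNextCopy : targets z (bit (headParity j 0ℙ)) (headLayer j) (girthWalk (suc j)) ≡ true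
    arcToNextCopy with suc j ≟ m
    ... | yes refl = subst (λ y → targets z 1 0 y ≡ true) (sym girthWalk-m) (targets-∋ 1 0 1≤z)
    ... | no j+1≢m = subst (λ y → targets z 0 (suc j) y ≡ true) (sym (girthWalk-< (≤∧≢⇒< j<m j+1≢m)))
                           (targets-∋ 0 (suc j) 1≤z)

  girthEdge : isEdge (girthWalk m) (girthWalk (suc m)) ≡ true
  girthEdge rewrite girthWalk-m | girthWalk-end =
    trans (cong (does (0 ≟ rotate 1) ∨_) (dec-true (1 ≟ rotate 0) (sym rotate0≡1))) (∨-zeroʳ _)
    where
    rotate0≡1 : rotate 0 ≡ 1
    rotate0≡1 = begin
      vertex (next (pos 0)) (layer 0) ≡⟨ cong₂ (λ t a → vertex (next t) a) (pos-vertex 0 0<L) (layer-vertex 0 0<L) ⟩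
      next 0 + 0                      ≡⟨ +-identityʳ (next 0) ⟩
      1 % L                           ≡⟨ m<n⇒m%n≡m 1<L ⟩
      1                               ∎
      where open ≡-Reasoning

  girthWalk-injective : ∀ {i j} → i < m → j < m → girthWalk i ≡ girthWalk j → i ≡ j
  girthWalk-injective {i} {j} i<m j<m eq = begin
    i                    ≡⟨ layer-vertex i 0<L ⟨
    layer (vertex 0 i)   ≡⟨ cong layer (trans (sym (girthWalk-< i<m)) (trans eq (girthWalk-< j<m))) ⟩
    layer (vertex 0 j)   ≡⟨ layer-vertex j 0<L ⟩
    j                    ∎
    where open ≡-Reasoning

  girthStep : ∀ j → j < suc m →
      (does (j ≟ m) ≡ true  × isEdge (girthWalk j) (girthWalk (suc j)) ≡ true)
    ⊎ (does (j ≟ m) ≡ false × isArc  (girthWalk j) (girthWalk (suc j)) ≡ true)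
  girthStep j j≤m with j ≟ m
  ... | yes refl = inj₁ (dec-true (m ≟ m) refl , girthEdge)
  ... | no  j≢m  = inj₂ (dec-false (j ≟ m) j≢m , girthArc (≤∧≢⇒< (s≤s⁻¹ j≤m) j≢m))

  girthCycle : Cycle graph (suc m)
  girthCycle = record
    { vert     = vert
    ; tag      = λ i → does (toℕ i ≟ m)
    ; closed   = toℕ-injective (trans (toℕ-vert zero) (sym (trans (toℕ-vert (fromℕ (suc m)))
                   (trans (cong girthWalk (toℕ-fromℕ (suc m))) (trans girthWalk-end (sym (girthWalk-< 0<m)))))))
    ; nonTriv  = s≤s z≤n
    ; stepOK   = λ i → subst₂ (λ u v →
                   (does (toℕ i ≟ m) ≡ true × isEdge u v ≡ true) ⊎ (does (toℕ i ≟ m) ≡ false × isArc u v ≡ true))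
                   (sym (trans (toℕ-vert (inject₁ i)) (cong girthWalk (toℕ-inject₁ i)))) (sym (toℕ-vert (suc i)))
                   (girthStep (toℕ i) (toℕ<n i))
    ; distinct = λ where
        i j i≢j (inj₁ (edgeᵢ , edgeⱼ , _)) →
          i≢j (toℕ-injective (trans (does⇒ (_ ≟ m) edgeᵢ) (sym (does⇒ (_ ≟ m) edgeⱼ))))
        i j i≢j (inj₂ (arcᵢ , arcⱼ , sameTail , _)) → i≢j (toℕ-injective (girthWalk-injective
          (arcIndex<m i arcᵢ) (arcIndex<m j arcⱼ) (begin
            girthWalk (toℕ i)           ≡⟨ cong girthWalk (toℕ-inject₁ i) ⟨
            girthWalk (toℕ (inject₁ i)) ≡⟨ toℕ-vert (inject₁ i) ⟨
            toℕ (vert (inject₁ i))      ≡⟨ cong toℕ sameTail ⟩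
            toℕ (vert (inject₁ j))      ≡⟨ toℕ-vert (inject₁ j) ⟩
            girthWalk (toℕ (inject₁ j)) ≡⟨ cong girthWalk (toℕ-inject₁ j) ⟩
            girthWalk (toℕ j)           ∎)))
    }
    where
    open ≡-Reasoning
    vert : Fin (suc (suc m)) → Fin n
    vert i = fromℕ< (girthWalk<n (toℕ i))
    toℕ-vert : ∀ i → toℕ (vert i) ≡ girthWalk (toℕ i)
    toℕ-vert i = toℕ-fromℕ< (girthWalk<n (toℕ i))
    arcIndex<m : ∀ (i : Fin (suc m)) → does (toℕ i ≟ m) ≡ false → toℕ i < m
    arcIndex<m i arc = ≤∧≢⇒< (s≤s⁻¹ (toℕ<n i)) (does≡false⇒¬ (toℕ i ≟ m) arc)

  layeredGraph : IsRZGGraph graph 2 z (suc m)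
  layeredGraph = graph-degree , graph-outDegree , girthCycle , noShortCycle

fBoundedBy-layered : ∀ {m h z N} → 2 ≤ m → m < h + h → 1 ≤ z → z ≤ h → m * (h + h) ≤ N →
  fBoundedBy 2 z (suc m) N
fBoundedBy-layered {m} {h} {z} 2≤m m<L 1≤z z≤h bound = m * (h + h) , bound , graph , layeredGraph
  where open LayeredCycles m h z 2≤m m<L 1≤z z≤h

fBoundedBy-even : ∀ {m h z} → 2 ≤ m → suc m ≡ h + h → 1 ≤ z → z ≤ h →
  fBoundedBy 2 z (suc m) (suc m * suc m ∸ suc m)
fBoundedBy-even {m} 2≤m g≡L 1≤z z≤h = fBoundedBy-layered 2≤m (subst (m <_) g≡L ≤-refl) 1≤z z≤h
  (≤-reflexive (trans (cong (m *_) (sym g≡L)) (sym (m+n∸m≡n (suc m) (m * suc m)))))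

fBoundedBy-odd : ∀ {m h z} → 2 ≤ m → suc (suc m) ≡ h + h → 1 ≤ z → z ≤ h →
  fBoundedBy 2 z (suc m) (suc m * suc m ∸ 1)
fBoundedBy-odd {m} 2≤m g+1≡L 1≤z z≤h = fBoundedBy-layered 2≤m (subst (m <_) g+1≡L (n≤1+n (suc m))) 1≤z z≤h
  (≤-reflexive (trans (cong (m *_) (sym g+1≡L)) (*-suc m (suc m))))

2∣n⊎2∣1+n : ∀ n → 2 ∣ n ⊎ 2 ∣ suc n
2∣n⊎2∣1+n zero    = inj₁ (divides 0 refl)
2∣n⊎2∣1+n (suc n) with 2∣n⊎2∣1+n n
... | inj₁ (divides q n≡q*2) = inj₂ (divides (suc q) (cong (2 +_) n≡q*2))
... | inj₂ 2∣n+1             = inj₁ 2∣n+1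

n*2≡n+n : ∀ n → n * 2 ≡ n + n
n*2≡n+n n = trans (*-comm n 2) (cong (n +_) (+-identityʳ n))

mainTheorem4 : (g z : ℕ) → 5 ≤ g → 1 ≤ z →
    ((2 ∣ g → z ≤ g / 2 → fBoundedBy 2 z g (g * g ∸ g))
    × (¬ (2 ∣ g) → z ≤ (g + 1) / 2 → fBoundedBy 2 z g (g * g ∸ 1)))
mainTheorem4 (suc m) z (s≤s 4≤m) 1≤z = even , odd
  where
  2≤m : 2 ≤ m
  2≤m = ≤-trans (s≤s (s≤s z≤n)) 4≤m
  even : 2 ∣ suc m → z ≤ suc m / 2 → fBoundedBy 2 z (suc m) (suc m * suc m ∸ suc m)
  even (divides h g≡h*2) z≤g/2 = fBoundedBy-even 2≤m (trans g≡h*2 (n*2≡n+n h)) 1≤z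
    (subst (z ≤_) (trans (cong (_/ 2) g≡h*2) (m*n/n≡m h 2)) z≤g/2)
  odd : ¬ 2 ∣ suc m → z ≤ (suc m + 1) / 2 → fBoundedBy 2 z (suc m) (suc m * suc m ∸ 1)
  odd g-odd z≤[g+1]/2 with 2∣n⊎2∣1+n m
  ... | inj₂ 2∣g             = ⊥-elim (g-odd 2∣g)
  ... | inj₁ (divides q m≡q*2) = fBoundedBy-odd 2≤m (trans g+1≡h*2 (n*2≡n+n (suc q))) 1≤z
    (subst (z ≤_) (trans (cong (_/ 2) (trans (+-comm (suc m) 1) g+1≡h*2)) (m*n/n≡m (suc q) 2)) z≤[g+1]/2)
    where
    g+1≡h*2 : suc (suc m) ≡ suc q * 2
    g+1≡h*2 = cong (2 +_) m≡q*2
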